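{- Let $\{x_k\}_{k\ge0}$ be a log-convex sequence of nonnegative real numbers, and define $z_n=\sum_{k=0}^{n}c(n,k)x_k$ for $n\ge 0$, where $c(n,k)$ is the signless Stirling number of the first kind. Then $\{z_n\}_{n\ge0}$ is log-convex.
   Context: A sequence $a_0,a_1,a_2,\ldots$ of nonnegative real numbers is log-convex if $a_{k-1}a_{k+1}\ge a_k^2$ for all $k\ge1$. $c(n,k)$ is the number of permutations of $\{1,\dots,n\}$ having exactly $k$ cycles (with $c(0,0)=1$). -}

module Defs where

open import Level using (0ℓ)
open import Data.Nat as ℕ using (ℕ; zero; suc)
open import Data.Product using (Σ; ∃; _×_)
open import Relation.Nullary using (¬_)
open import Relation.Binary.Core using (Rel)
open import Relation.Binary.Structures using (IsTotalOrder)
open import Algebra.Bundles using (CommutativeRing)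

stirling1 : ℕ → ℕ → ℕ
stirling1 zero    zero    = 1
stirling1 zero    (suc k) = 0
stirling1 (suc n) zero    = 0
stirling1 (suc n) (suc k) = n ℕ.* stirling1 n (suc k) ℕ.+ stirling1 n k

record RealNumbers : Set₁ where
  field
    commutativeRing : CommutativeRing 0ℓ 0ℓ
  open CommutativeRing commutativeRing public
  field
    _≤_          : Rel Carrier 0ℓ
    isTotalOrder : IsTotalOrder _≈_ _≤_
    +-mono-≤     : ∀ {x y} z → x ≤ y → (x + z) ≤ (y + z)
    *-nonneg     : ∀ {x y} → 0# ≤ x → 0# ≤ y → 0# ≤ (x * y)
    nontrivial   : ¬ (0# ≈ 1#)
    inverse      : ∀ x → ¬ (x ≈ 0#) → Σ Carrier (λ y → (x * y) ≈ 1#)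
    complete     : (P : Carrier → Set) → Σ Carrier P →
                   Σ Carrier (λ b → ∀ x → P x → x ≤ b) →
                   Σ Carrier (λ s → (∀ x → P x → x ≤ s) ×
                                    (∀ b → (∀ x → P x → x ≤ b) → s ≤ b))

  fromℕ : ℕ → Carrier
  fromℕ zero    = 0#
  fromℕ (suc n) = 1# + fromℕ n

  sumTo : ℕ → (ℕ → Carrier) → Carrier
  sumTo zero    f = f 0
  sumTo (suc n) f = sumTo n f + f (suc n)

  LogConvex : (ℕ → Carrier) → Set
  LogConvex a = (∀ k → 0# ≤ a k) ×
                (∀ k → (a (suc k) * a (suc k)) ≤ (a k * a (suc (suc k))))

  stirlingTransform : (ℕ → Carrier) → ℕ → Carrier
  stirlingTransform x n = sumTo n (λ k → fromℕ (stirling1 n k) * x k)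

module Submission where

-- Write z_n(y) for the Stirling transform of a sequence y and S for the shift.
-- The recurrence c(n+1,k+1) = n c(n,k+1) + c(n,k) gives z_{n+1}(y) = n z_n(y) + z_n(Sy),
-- so the row k ↦ z_{n+1}(S^k x) is obtained from the row k ↦ z_n(S^k x) by u ↦ n u + S u.
-- This map preserves log-convexity of nonnegative sequences, because a log-convex u also
-- satisfies u_{k+1} u_{k+2} ≤ u_k u_{k+3}; hence every row is log-convex.  Expressing
-- z_{n+1} and z_{n+2} through a = z_n(x), b = z_n(Sx), c = z_n(S²x), the inequality
-- z_{n+1}² ≤ z_n z_{n+2} reduces to b² ≤ a c.
-- The inequality u_{k+1} u_{k+2} ≤ u_k u_{k+3} comes from (bc)² ≤ (ad)(bc), which needs
-- "x² ≤ 0 implies x ≤ 0".  Constructively the field axioms only make x ≉ 0 absurd, so this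
-- is proved from completeness instead: the multiples of such an x are bounded by 1, and
-- an archimedean argument with their supremum gives x ≤ 0.

open import Defs
open import Data.Nat as ℕ using (ℕ; zero; suc; _<_; s≤s)
import Data.Nat.Properties as ℕₚ
open import Data.Product using (Σ; _,_; proj₁; proj₂)
open import Data.Sum using (inj₁; inj₂)
open import Relation.Binary.PropositionalEquality as ≡ using (_≡_)
open import Relation.Binary.Structures using (IsTotalOrder)
open import Relation.Binary.Bundles using (Poset)
open import Level using (0ℓ)

stirling1-above-diagonal : ∀ {n k} → n < k → stirling1 n k ≡ 0
stirling1-above-diagonal {zero}  {suc k} _ = ≡.refl
stirling1-above-diagonal {suc n} {suc k} (s≤s n<k)
  rewrite stirling1-above-diagonal (ℕₚ.m<n⇒m<1+n n<k) | stirling1-above-diagonal n<k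
  = ≡.cong (ℕ._+ 0) (ℕₚ.*-zeroʳ n)

n*stirling1[n,0]≡0 : ∀ n → n ℕ.* stirling1 n 0 ≡ 0
n*stirling1[n,0]≡0 zero    = ≡.refl
n*stirling1[n,0]≡0 (suc n) = ℕₚ.*-zeroʳ (suc n)

module _ (R : RealNumbers) where

  -- Defs declares _≤_ without a fixity.
  open RealNumbers R renaming (+-mono-≤ to +-monoˡ-≤; _≤_ to infix 4 _≤_)
  open IsTotalOrder isTotalOrder using (total; ≤-respˡ-≈; ≤-respʳ-≈)
    renaming (refl to ≤-refl; trans to ≤-trans)
  open import Algebra.Properties.Group +-group
    using (⁻¹-involutive) renaming (//-rightDividesˡ to [y-x]+x≈y; //-rightDividesʳ to [y+x]-x≈y)
  open import Algebra.Properties.Ring ring using (-‿distribˡ-*; x[y-z]≈xy-xz)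
  open import Algebra.Properties.Semiring.Mult semiring using (_×_; ×-homo-+; ×1-homo-*)
  open import Algebra.Solver.Ring.NaturalCoefficients.Default commutativeSemiring

  ≤-poset : Poset 0ℓ 0ℓ 0ℓ
  ≤-poset = record { isPartialOrder = IsTotalOrder.isPartialOrder isTotalOrder }

  open import Relation.Binary.Reasoning.PartialOrder ≤-poset

  +-monoʳ-≤ : ∀ z {x y} → x ≤ y → z + x ≤ z + y
  +-monoʳ-≤ z {x} {y} x≤y = begin
    z + x ≈⟨ +-comm z x ⟩
    x + z ≤⟨ +-monoˡ-≤ z x≤y ⟩
    y + z ≈⟨ +-comm y z ⟩
    z + y ∎

  +-mono-≤ : ∀ {x y u v} → x ≤ y → u ≤ v → x + u ≤ y + v
  +-mono-≤ {y = y} {u} x≤y u≤v = ≤-trans (+-monoˡ-≤ u x≤y) (+-monoʳ-≤ y u≤v)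

  +-cancelʳ-≤ : ∀ z {x y} → x + z ≤ y + z → x ≤ y
  +-cancelʳ-≤ z {x} {y} x+z≤y+z = begin
    x           ≈⟨ [y+x]-x≈y z x ⟨
    x + z - z   ≤⟨ +-monoˡ-≤ (- z) x+z≤y+z ⟩
    y + z - z   ≈⟨ [y+x]-x≈y z y ⟩
    y           ∎

  x≤y⇒0≤y-x : ∀ {x y} → x ≤ y → 0# ≤ y - x
  x≤y⇒0≤y-x {x} {y} x≤y = begin
    0#    ≈⟨ -‿inverseʳ x ⟨
    x - x ≤⟨ +-monoˡ-≤ (- x) x≤y ⟩
    y - x ∎

  x≤x+y : ∀ x {y} → 0# ≤ y → x ≤ x + y
  x≤x+y x {y} 0≤y = begin
    x      ≈⟨ +-identityʳ x ⟨
    x + 0# ≤⟨ +-monoʳ-≤ x 0≤y ⟩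
    x + y  ∎

  +-nonneg : ∀ {x y} → 0# ≤ x → 0# ≤ y → 0# ≤ x + y
  +-nonneg {x} {y} 0≤x 0≤y = ≤-trans 0≤x (x≤x+y x 0≤y)

  *-monoʳ-≤-nonneg : ∀ {z x y} → 0# ≤ z → x ≤ y → z * x ≤ z * y
  *-monoʳ-≤-nonneg {z} {x} {y} 0≤z x≤y = begin
    z * x               ≤⟨ x≤x+y (z * x) (*-nonneg 0≤z (x≤y⇒0≤y-x x≤y)) ⟩
    z * x + z * (y - x) ≈⟨ distribˡ z x (y - x) ⟨
    z * (x + (y - x))   ≈⟨ *-congˡ (+-comm x (y - x)) ⟩
    z * (y - x + x)     ≈⟨ *-congˡ ([y-x]+x≈y x y) ⟩
    z * y               ∎

  *-mono-≤-nonneg : ∀ {x y u v} → 0# ≤ x → 0# ≤ u → x ≤ y → u ≤ v → x * u ≤ y * v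
  *-mono-≤-nonneg {x} {y} {u} {v} 0≤x 0≤u x≤y u≤v = begin
    x * u ≤⟨ *-monoʳ-≤-nonneg 0≤x u≤v ⟩
    x * v ≈⟨ *-comm x v ⟩
    v * x ≤⟨ *-monoʳ-≤-nonneg (≤-trans 0≤u u≤v) x≤y ⟩
    v * y ≈⟨ *-comm v y ⟩
    y * v ∎

  0≤1 : 0# ≤ 1#
  0≤1 with total 0# 1#
  ... | inj₁ 0≤1 = 0≤1
  ... | inj₂ 1≤0 = begin
    0#            ≤⟨ *-nonneg 0≤-1 0≤-1 ⟩
    - 1# * - 1#   ≈⟨ -‿distribˡ-* 1# (- 1#) ⟨
    - (1# * - 1#) ≈⟨ -‿cong (*-identityˡ (- 1#)) ⟩
    - - 1#        ≈⟨ ⁻¹-involutive 1# ⟩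
    1#            ∎
    where
    0≤-1 : 0# ≤ - 1#
    0≤-1 = ≤-respʳ-≈ (+-identityˡ (- 1#)) (x≤y⇒0≤y-x 1≤0)

  fromℕ≡×1 : ∀ n → fromℕ n ≡ n × 1#
  fromℕ≡×1 zero    = ≡.refl
  fromℕ≡×1 (suc n) = ≡.cong (1# +_) (fromℕ≡×1 n)

  fromℕ-+ : ∀ m n → fromℕ (m ℕ.+ n) ≈ fromℕ m + fromℕ n
  fromℕ-+ m n
    rewrite fromℕ≡×1 (m ℕ.+ n) | fromℕ≡×1 m | fromℕ≡×1 n = ×-homo-+ 1# m n

  fromℕ-* : ∀ m n → fromℕ (m ℕ.* n) ≈ fromℕ m * fromℕ n
  fromℕ-* m n
    rewrite fromℕ≡×1 (m ℕ.* n) | fromℕ≡×1 m | fromℕ≡×1 n = ×1-homo-* m n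

  fromℕ-nonneg : ∀ n → 0# ≤ fromℕ n
  fromℕ-nonneg zero    = ≤-refl
  fromℕ-nonneg (suc n) = +-nonneg 0≤1 (fromℕ-nonneg n)

  multiples-bounded⇒≤0 : ∀ {x b} → (∀ n → fromℕ n * x ≤ b) → x ≤ 0#
  multiples-bounded⇒≤0 {x} {b} nx≤b = +-cancelʳ-≤ s (begin
    x + s           ≈⟨ +-comm x s ⟩
    s + x           ≤⟨ +-monoˡ-≤ x s≤s-x ⟩
    s - x + x       ≈⟨ [y-x]+x≈y x s ⟩
    s               ≈⟨ +-identityˡ s ⟨
    0# + s          ∎)
    where
    Multiple : Carrier → Set
    Multiple y = Σ ℕ λ n → y ≈ fromℕ n * x

    multiple≤b : ∀ y → Multiple y → y ≤ b
    multiple≤b y (n , y≈nx) = ≤-respˡ-≈ (sym y≈nx) (nx≤b n)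

    supremum = complete Multiple (0# , 0 , sym (zeroˡ x)) (b , multiple≤b)

    s : Carrier
    s = proj₁ supremum

    multiple≤s : ∀ y → Multiple y → y ≤ s
    multiple≤s = proj₁ (proj₂ supremum)

    s-isLeast : ∀ c → (∀ y → Multiple y → y ≤ c) → s ≤ c
    s-isLeast = proj₂ (proj₂ supremum)

    s-x-isUpperBound : ∀ y → Multiple y → y ≤ s - x
    s-x-isUpperBound y (n , y≈nx) = begin
      y         ≈⟨ [y+x]-x≈y x y ⟨
      y + x - x ≤⟨ +-monoˡ-≤ (- x) (multiple≤s (y + x) (suc n , y+x≈[1+n]x)) ⟩
      s - x     ∎
      where
      y+x≈[1+n]x : y + x ≈ fromℕ (suc n) * x
      y+x≈[1+n]x = begin-equality
        y + x                  ≈⟨ +-comm y x ⟩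
        x + y                  ≈⟨ +-cong (sym (*-identityˡ x)) y≈nx ⟩
        1# * x + fromℕ n * x   ≈⟨ distribʳ x 1# (fromℕ n) ⟨
        (1# + fromℕ n) * x     ∎

    s≤s-x : s ≤ s - x
    s≤s-x = s-isLeast (s - x) s-x-isUpperBound

  x*x≤0⇒x≤0 : ∀ {x} → x * x ≤ 0# → x ≤ 0#
  x*x≤0⇒x≤0 {x} x*x≤0 with total x 0#
  ... | inj₁ x≤0 = x≤0
  ... | inj₂ 0≤x = multiples-bounded⇒≤0 nx≤1
    where
    nx≤1 : ∀ n → fromℕ n * x ≤ 1#
    nx≤1 n with total (fromℕ n * x) 1#
    ... | inj₁ nx≤1 = nx≤1
    ... | inj₂ 1≤nx = begin
      N * x              ≈⟨ *-identityʳ (N * x) ⟨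
      N * x * 1#         ≤⟨ *-monoʳ-≤-nonneg 0≤nx 1≤nx ⟩
      N * x * (N * x)    ≈⟨ solve 2 (λ N x → N :* x :* (N :* x) := N :* N :* (x :* x)) refl N x ⟩
      N * N * (x * x)    ≤⟨ *-monoʳ-≤-nonneg (*-nonneg 0≤N 0≤N) x*x≤0 ⟩
      N * N * 0#         ≈⟨ zeroʳ (N * N) ⟩
      0#                 ≤⟨ 0≤1 ⟩
      1#                 ∎
      where
      N = fromℕ n
      0≤N = fromℕ-nonneg n
      0≤nx = *-nonneg 0≤N 0≤x

  x*x≤y*x⇒x≤y : ∀ {x y} → 0# ≤ y → x * x ≤ y * x → x ≤ y
  x*x≤y*x⇒x≤y {x} {y} 0≤y x*x≤y*x with total x y
  ... | inj₁ x≤y = x≤y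
  ... | inj₂ y≤x = begin
    x          ≈⟨ [y-x]+x≈y y x ⟨
    x - y + y  ≤⟨ +-monoˡ-≤ y (x*x≤0⇒x≤0 e*e≤0) ⟩
    0# + y     ≈⟨ +-identityˡ y ⟩
    y          ∎
    where
    e : Carrier
    e = x - y

    0≤e : 0# ≤ e
    0≤e = x≤y⇒0≤y-x y≤x

    e*e≤0 : e * e ≤ 0#
    e*e≤0 = begin
      e * e               ≤⟨ x≤x+y (e * e) (*-nonneg 0≤y 0≤e) ⟩
      e * e + y * e       ≈⟨ distribʳ e e y ⟨
      (e + y) * e         ≈⟨ *-congʳ ([y-x]+x≈y y x) ⟩
      x * e               ≈⟨ x[y-z]≈xy-xz x x y ⟩
      x * x - x * y       ≤⟨ +-monoˡ-≤ (- (x * y)) x*x≤y*x ⟩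
      y * x - x * y       ≈⟨ +-congʳ (*-comm y x) ⟩
      x * y - x * y       ≈⟨ -‿inverseʳ (x * y) ⟩
      0#                  ∎

  LogConvex-resp-≈ : ∀ {u v} → (∀ k → u k ≈ v k) → LogConvex u → LogConvex v
  LogConvex-resp-≈ {u} {v} u≈v (0≤u , u-logConvex) = 0≤v , v-logConvex
    where
    0≤v : ∀ k → 0# ≤ v k
    0≤v k = ≤-respʳ-≈ (u≈v k) (0≤u k)

    v-logConvex : ∀ k → v (suc k) * v (suc k) ≤ v k * v (suc (suc k))
    v-logConvex k = begin
      v (suc k) * v (suc k)     ≈⟨ *-cong (u≈v (suc k)) (u≈v (suc k)) ⟨
      u (suc k) * u (suc k)     ≤⟨ u-logConvex k ⟩
      u k * u (suc (suc k))     ≈⟨ *-cong (u≈v k) (u≈v (suc (suc k))) ⟩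
      v k * v (suc (suc k))     ∎

  LogConvex⇒inner≤outer : ∀ {u} → LogConvex u →
                          ∀ k → u (1 ℕ.+ k) * u (2 ℕ.+ k) ≤ u k * u (3 ℕ.+ k)
  LogConvex⇒inner≤outer {u} (0≤u , u-logConvex) k =
    x*x≤y*x⇒x≤y (*-nonneg (0≤u k) (0≤u (3 ℕ.+ k))) (begin
      (u₁ * u₂) * (u₁ * u₂)  ≈⟨ solve 2 (λ a b → a :* b :* (a :* b) := a :* a :* (b :* b))
                                   refl u₁ u₂ ⟩
      (u₁ * u₁) * (u₂ * u₂)  ≤⟨ *-mono-≤-nonneg (*-nonneg 0≤u₁ 0≤u₁) (*-nonneg 0≤u₂ 0≤u₂)
                                  (u-logConvex k) (u-logConvex (suc k)) ⟩
      (u₀ * u₂) * (u₁ * u₃)  ≈⟨ solve 4 (λ a b c d → a :* c :* (b :* d) := a :* d :* (b :* c))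
                                   refl u₀ u₁ u₂ u₃ ⟩
      (u₀ * u₃) * (u₁ * u₂)  ∎)
    where
    u₀ = u k
    u₁ = u (1 ℕ.+ k)
    u₂ = u (2 ℕ.+ k)
    u₃ = u (3 ℕ.+ k)
    0≤u₁ = 0≤u (1 ℕ.+ k)
    0≤u₂ = 0≤u (2 ℕ.+ k)

  LogConvex-*-+-shift : ∀ {m u} → 0# ≤ m → LogConvex u →
                        LogConvex (λ k → m * u k + u (suc k))
  LogConvex-*-+-shift {m} {u} 0≤m u-lc@(0≤u , u-logConvex) = 0≤v , v-logConvex
    where
    v : ℕ → Carrier
    v k = m * u k + u (suc k)

    0≤v : ∀ k → 0# ≤ v k
    0≤v k = +-nonneg (*-nonneg 0≤m (0≤u k)) (0≤u (suc k))

    v-logConvex : ∀ k → v (suc k) * v (suc k) ≤ v k * v (suc (suc k))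
    v-logConvex k = begin
      (m * u₁ + u₂) * (m * u₁ + u₂)
        ≈⟨ solve 3 (λ m a b → (m :* a :+ b) :* (m :* a :+ b)
                              := m :* m :* (a :* a) :+ m :* (a :* b) :+ m :* (a :* b) :+ b :* b)
                   refl m u₁ u₂ ⟩
      m * m * (u₁ * u₁) + m * (u₁ * u₂) + m * (u₁ * u₂) + u₂ * u₂
        ≤⟨ +-mono-≤ (+-mono-≤ (+-mono-≤ (*-monoʳ-≤-nonneg (*-nonneg 0≤m 0≤m) (u-logConvex k))
                                        (*-monoʳ-≤-nonneg 0≤m (LogConvex⇒inner≤outer u-lc k)))
                              ≤-refl)
                    (u-logConvex (suc k)) ⟩
      m * m * (u₀ * u₂) + m * (u₀ * u₃) + m * (u₁ * u₂) + u₁ * u₃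
        ≈⟨ solve 5 (λ m a b c d → m :* m :* (a :* c) :+ m :* (a :* d) :+ m :* (b :* c) :+ b :* d
                                  := (m :* a :+ b) :* (m :* c :+ d))
                   refl m u₀ u₁ u₂ u₃ ⟩
      (m * u₀ + u₁) * (m * u₂ + u₃) ∎
      where
      u₀ = u k
      u₁ = u (1 ℕ.+ k)
      u₂ = u (2 ℕ.+ k)
      u₃ = u (3 ℕ.+ k)

  sumTo-cong : ∀ n {f g : ℕ → Carrier} → (∀ k → f k ≈ g k) → sumTo n f ≈ sumTo n g
  sumTo-cong zero    f≈g = f≈g 0
  sumTo-cong (suc n) f≈g = +-cong (sumTo-cong n f≈g) (f≈g (suc n))

  sumTo-distrib-+ : ∀ n (f g : ℕ → Carrier) →
                    sumTo n (λ k → f k + g k) ≈ sumTo n f + sumTo n g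
  sumTo-distrib-+ zero    f g = refl
  sumTo-distrib-+ (suc n) f g = trans (+-congʳ (sumTo-distrib-+ n f g))
    (solve 4 (λ a b c d → a :+ b :+ (c :+ d) := a :+ c :+ (b :+ d)) refl
       (sumTo n f) (sumTo n g) (f (suc n)) (g (suc n)))

  *-distribˡ-sumTo : ∀ n a (f : ℕ → Carrier) → a * sumTo n f ≈ sumTo n (λ k → a * f k)
  *-distribˡ-sumTo zero    a f = refl
  *-distribˡ-sumTo (suc n) a f =
    trans (distribˡ a (sumTo n f) (f (suc n))) (+-congʳ (*-distribˡ-sumTo n a f))

  sumTo-head : ∀ n (f : ℕ → Carrier) → sumTo (suc n) f ≈ f 0 + sumTo n (λ k → f (suc k))
  sumTo-head zero    f = refl
  sumTo-head (suc n) f = trans (+-congʳ (sumTo-head n f)) (+-assoc (f 0) _ _)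

  stirlingTransform-cong : ∀ {x y} → (∀ k → x k ≈ y k) →
                           ∀ n → stirlingTransform x n ≈ stirlingTransform y n
  stirlingTransform-cong x≈y n = sumTo-cong n (λ k → *-congˡ (x≈y k))

  stirlingTransform-zero : ∀ x → stirlingTransform x 0 ≈ x 0
  stirlingTransform-zero x = trans (*-congʳ (+-identityʳ 1#)) (*-identityˡ (x 0))

  stirlingTransform-suc : ∀ x n → stirlingTransform x (suc n) ≈
                          fromℕ n * stirlingTransform x n + stirlingTransform (λ k → x (suc k)) n
  stirlingTransform-suc x n = begin-equality
    sumTo (suc n) (λ k → fromℕ (stirling1 (suc n) k) * x k)
      ≈⟨ sumTo-cong (suc n) stirling1-suc ⟩
    sumTo (suc n) (λ k → m * term k + shifted k)
      ≈⟨ sumTo-distrib-+ (suc n) (λ k → m * term k) shifted ⟩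
    sumTo (suc n) (λ k → m * term k) + sumTo (suc n) shifted
      ≈⟨ +-cong (*-distribˡ-sumTo (suc n) m term) refl ⟨
    m * sumTo (suc n) term + sumTo (suc n) shifted
      ≈⟨ +-cong (*-congˡ last-term-vanishes) (sumTo-head n shifted) ⟩
    m * stirlingTransform x n + (0# + stirlingTransform (λ k → x (suc k)) n)
      ≈⟨ +-congˡ (+-identityˡ _) ⟩
    m * stirlingTransform x n + stirlingTransform (λ k → x (suc k)) n ∎
    where
    m = fromℕ n

    term : ℕ → Carrier
    term k = fromℕ (stirling1 n k) * x k

    shifted : ℕ → Carrier
    shifted zero    = 0#
    shifted (suc k) = fromℕ (stirling1 n k) * x (suc k)

    stirling1-suc : ∀ k → fromℕ (stirling1 (suc n) k) * x k ≈ m * term k + shifted k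
    stirling1-suc zero = begin-equality
      0# * x 0                           ≈⟨ *-congʳ (reflexive (≡.cong fromℕ (n*stirling1[n,0]≡0 n))) ⟨
      fromℕ (n ℕ.* stirling1 n 0) * x 0  ≈⟨ *-congʳ (fromℕ-* n (stirling1 n 0)) ⟩
      m * fromℕ (stirling1 n 0) * x 0    ≈⟨ *-assoc m _ (x 0) ⟩
      m * term 0                         ≈⟨ +-identityʳ (m * term 0) ⟨
      m * term 0 + 0#                    ∎
    stirling1-suc (suc k) = begin-equality
      fromℕ (n ℕ.* stirling1 n (suc k) ℕ.+ stirling1 n k) * x (suc k)
        ≈⟨ *-congʳ (trans (fromℕ-+ (n ℕ.* stirling1 n (suc k)) (stirling1 n k))
                           (+-congʳ (fromℕ-* n (stirling1 n (suc k))))) ⟩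
      (m * fromℕ (stirling1 n (suc k)) + fromℕ (stirling1 n k)) * x (suc k)
        ≈⟨ solve 4 (λ m a b y → (m :* a :+ b) :* y := m :* (a :* y) :+ b :* y) refl
             m (fromℕ (stirling1 n (suc k))) (fromℕ (stirling1 n k)) (x (suc k)) ⟩
      m * term (suc k) + shifted (suc k) ∎

    last-term-vanishes : sumTo (suc n) term ≈ stirlingTransform x n
    last-term-vanishes = begin-equality
      stirlingTransform x n + fromℕ (stirling1 n (suc n)) * x (suc n)
        ≈⟨ +-congˡ (*-congʳ (reflexive (≡.cong fromℕ (stirling1-above-diagonal (ℕₚ.n<1+n n))))) ⟩
      stirlingTransform x n + 0# * x (suc n)
        ≈⟨ +-congˡ (zeroˡ (x (suc n))) ⟩
      stirlingTransform x n + 0#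
        ≈⟨ +-identityʳ _ ⟩
      stirlingTransform x n ∎

  stirlingRow : (ℕ → Carrier) → ℕ → ℕ → Carrier
  stirlingRow x n k = stirlingTransform (λ j → x (k ℕ.+ j)) n

  stirlingRow-zero : ∀ x k → stirlingRow x 0 k ≈ x k
  stirlingRow-zero x k =
    trans (stirlingTransform-zero (λ j → x (k ℕ.+ j))) (reflexive (≡.cong x (ℕₚ.+-identityʳ k)))

  stirlingRow-suc : ∀ x n k → stirlingRow x (suc n) k ≈
                    fromℕ n * stirlingRow x n k + stirlingRow x n (suc k)
  stirlingRow-suc x n k = trans (stirlingTransform-suc (λ j → x (k ℕ.+ j)) n)
    (+-congˡ (stirlingTransform-cong (λ j → reflexive (≡.cong x (ℕₚ.+-suc k j))) n))

  stirlingRow-logConvex : ∀ {x} → LogConvex x → ∀ n → LogConvex (stirlingRow x n)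
  stirlingRow-logConvex {x} x-lc zero =
    LogConvex-resp-≈ (λ k → sym (stirlingRow-zero x k)) x-lc
  stirlingRow-logConvex {x} x-lc (suc n) =
    LogConvex-resp-≈ (λ k → sym (stirlingRow-suc x n k))
      (LogConvex-*-+-shift (fromℕ-nonneg n) (stirlingRow-logConvex x-lc n))

  -- For a, b, c the first entries of row n the two sides are z_{n+1}² and z_n z_{n+2};
  -- they differ by m a² + a b + (a c − b²).
  stirlingColumn-step : ∀ {m a b c} → 0# ≤ m → 0# ≤ a → 0# ≤ b → b * b ≤ a * c →
                        (m * a + b) * (m * a + b) ≤ a * ((1# + m) * (m * a + b) + (m * b + c))
  stirlingColumn-step {m} {a} {b} {c} 0≤m 0≤a 0≤b b*b≤a*c = begin
    (m * a + b) * (m * a + b)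
      ≈⟨ solve 3 (λ m a b → (m :* a :+ b) :* (m :* a :+ b)
                            := m :* m :* (a :* a) :+ m :* (a :* b) :+ m :* (a :* b) :+ b :* b)
                 refl m a b ⟩
    P + b * b
      ≤⟨ +-monoʳ-≤ P b*b≤a*c ⟩
    P + a * c
      ≤⟨ x≤x+y (P + a * c) (+-nonneg (*-nonneg 0≤m (*-nonneg 0≤a 0≤a)) (*-nonneg 0≤a 0≤b)) ⟩
    P + a * c + (m * (a * a) + a * b)
      ≈⟨ solve 4 (λ m a b c → m :* m :* (a :* a) :+ m :* (a :* b) :+ m :* (a :* b) :+ a :* c
                                :+ (m :* (a :* a) :+ a :* b)
                              := a :* ((con 1 :+ m) :* (m :* a :+ b) :+ (m :* b :+ c)))
                 refl m a b c ⟩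
    a * ((1# + m) * (m * a + b) + (m * b + c)) ∎
    where
    P : Carrier
    P = m * m * (a * a) + m * (a * b) + m * (a * b)

  stirlingTransform-logConvex : ∀ {x} → LogConvex x → LogConvex (stirlingTransform x)
  stirlingTransform-logConvex {x} x-lc = (λ n → proj₁ (row-lc n) 0) , z-logConvex
    where
    row : ℕ → ℕ → Carrier
    row = stirlingRow x

    row-lc : ∀ n → LogConvex (row n)
    row-lc = stirlingRow-logConvex x-lc

    z-logConvex : ∀ n → stirlingTransform x (suc n) * stirlingTransform x (suc n)
                        ≤ stirlingTransform x n * stirlingTransform x (suc (suc n))
    z-logConvex n = begin
      row (suc n) 0 * row (suc n) 0
        ≈⟨ *-cong z₁≈ z₁≈ ⟩
      (m * a + b) * (m * a + b)
        ≤⟨ stirlingColumn-step (fromℕ-nonneg n) (proj₁ (row-lc n) 0) (proj₁ (row-lc n) 1)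
                               (proj₂ (row-lc n) 0) ⟩
      a * ((1# + m) * (m * a + b) + (m * b + c))
        ≈⟨ *-congˡ z₂≈ ⟨
      row n 0 * row (suc (suc n)) 0 ∎
      where
      m = fromℕ n
      a = row n 0
      b = row n 1
      c = row n 2
      z₁≈ : row (suc n) 0 ≈ m * a + b
      z₁≈ = stirlingRow-suc x n 0
      z₂≈ : row (suc (suc n)) 0 ≈ (1# + m) * (m * a + b) + (m * b + c)
      z₂≈ = trans (stirlingRow-suc x (suc n) 0) (+-cong (*-congˡ z₁≈) (stirlingRow-suc x n 1))

proposition2p7 : (R : RealNumbers) → (x : ℕ → RealNumbers.Carrier R) →
                   RealNumbers.LogConvex R x →
                   RealNumbers.LogConvex R (RealNumbers.stirlingTransform R x)
proposition2p7 R x = stirlingTransform-logConvex R
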